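{- For every $n\geq1$ there exists a polynomial $\hat\Phi_n(\mathbf c,\mathbf d)$ in non-commuting variables $\mathbf c,\mathbf d$ such that $\hat\Phi_n(\mathbf a+\mathbf b,\ \mathbf a\mathbf b+\mathbf b\mathbf a)=\hat\Psi_n(\mathbf a,\mathbf b)$; namely, $\hat\Phi_n(\mathbf c,\mathbf d)=\Phi_n(\mathbf c,\ \mathbf c^2-\mathbf d)$.
   Context: Fix $n$. For $S\subseteq[n-1]$ let $u_S=u_1\cdots u_{n-1}$ be the monomial in non-commuting variables $\mathbf a,\mathbf b$ with $u_i=\mathbf a$ if $i\notin S$ and $u_i=\mathbf b$ if $i\in S$. Let $\beta_n(S)$ be the number of $\sigma\in\mathfrak S_n$ with descent set $\{i:\sigma_i>\sigma_{i+1}\}=S$, and $\Psi_n(\mathbf a,\mathbf b)=\sum_S\beta_n(S)u_S$ (the $ab$-index of the Boolean algebra $B_n$). It is known that there is a (unique) polynomial $\Phi_n(\mathbf c,\mathbf d)$ in non-commuting $\mathbf c,\mathbf d$ (the $cd$-index of $B_n$) with $\Psi_n(\mathbf a,\mathbf b)=\Phi_n(\mathbf a+\mathbf b,\mathbf a\mathbf b+\mathbf b\mathbf a)$. Let $\hat\beta_n(S)$ be the number of $\sigma\in\mathfrak S_n$ whose alternating descent set equals $S$, where the alternating descent set is the set of $i\in[n-1]$ such that either $i$ is odd and $\sigma_i>\sigma_{i+1}$, or $i$ is even and $\sigma_i<\sigma_{i+1}$; and $\hat\Psi_n(\mathbf a,\mathbf b)=\sum_{S\subseteq[n-1]}\hat\beta_n(S)u_S$.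 -}

module Defs where

open import Data.Nat using (ℕ; zero; suc; _∸_; _<ᵇ_)
open import Data.Integer using (ℤ; +_; -_) renaming (_+_ to _+ℤ_; _*_ to _*ℤ_)
open import Data.List using (List; []; _∷_; _++_; map; concatMap; foldr; filter; length)
open import Data.List.Properties using (≡-dec)
open import Data.Product using (_×_; _,_)
open import Data.Bool using (Bool; true; false; not; if_then_else_)
open import Data.Fin using (Fin; toℕ)
import Data.Fin as Fin
open import Data.List.Relation.Unary.Unique.Propositional using (Unique)
import Data.List.Relation.Unary.Unique.DecPropositional as UniqueDec
open import Relation.Nullary using (yes; no; ¬_)
open import Relation.Binary.Definitions using (DecidableEquality)
open import Relation.Binary.PropositionalEquality using (_≡_; refl)

-- Non-commutative polynomials over ℤ in the letters of an alphabet X,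
-- represented as formal sums of terms (coefficient, monomial).

Poly : Set → Set
Poly X = List (ℤ × List X)

module _ {X : Set} where
  infixl 6 _⊕_ _⊖_
  infixl 7 _⊗_

  _⊕_ : Poly X → Poly X → Poly X
  p ⊕ q = p ++ q

  scale : ℤ → Poly X → Poly X
  scale c p = map (λ { (d , u) → (c *ℤ d , u) }) p

  _⊖_ : Poly X → Poly X → Poly X
  p ⊖ q = p ++ scale (- (+ 1)) q

  _⊗_ : Poly X → Poly X → Poly X
  p ⊗ q = concatMap (λ { (c , u) → map (λ { (d , v) → (c *ℤ d , u ++ v) }) q }) p

  one : Poly X
  one = (+ 1 , []) ∷ []

  var : X → Poly X
  var x = (+ 1 , x ∷ []) ∷ []

  coeff : DecidableEquality X → Poly X → List X → ℤ
  coeff _≟_ [] w = + 0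
  coeff _≟_ ((c , u) ∷ p) w with ≡-dec _≟_ u w
  ... | yes _ = c +ℤ coeff _≟_ p w
  ... | no _  = coeff _≟_ p w

  _≈[_]_ : Poly X → DecidableEquality X → Poly X → Set
  p ≈[ eq ] q = ∀ w → coeff eq p w ≡ coeff eq q w

substP : {X Y : Set} → (X → Poly Y) → Poly X → Poly Y
substP f p = concatMap (λ { (c , u) → scale c (foldr (λ x acc → f x ⊗ acc) one u) }) p

data AB : Set where
  𝐚 𝐛 : AB

data CD : Set where
  𝐜 𝐝 : CD

_≟AB_ : DecidableEquality AB
𝐚 ≟AB 𝐚 = yes refl
𝐚 ≟AB 𝐛 = no λ ()
𝐛 ≟AB 𝐚 = no λ ()
𝐛 ≟AB 𝐛 = yes refl

_≈ab_ : Poly AB → Poly AB → Set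
p ≈ab q = p ≈[ _≟AB_ ] q

cdToAB : CD → Poly AB
cdToAB 𝐜 = var 𝐚 ⊕ var 𝐛
cdToAB 𝐝 = var 𝐚 ⊗ var 𝐛 ⊕ var 𝐛 ⊗ var 𝐚

evalCD : Poly CD → Poly AB
evalCD = substP cdToAB

c,c²-d : CD → Poly CD
c,c²-d 𝐜 = var 𝐜
c,c²-d 𝐝 = var 𝐜 ⊗ var 𝐜 ⊖ var 𝐝

-- Permutations of [n], as the injective sequences σ₁…σₙ with σᵢ ∈ Fin n

allFin′ : (n : ℕ) → List (Fin n)
allFin′ n = Data.List.allFin n
  where import Data.List

seqs : (n k : ℕ) → List (List (Fin n))
seqs n zero = [] ∷ []
seqs n (suc k) = concatMap (λ x → map (x ∷_) (seqs n k)) (allFin′ n)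

perms : (n : ℕ) → List (List (Fin n))
perms n = filter (λ σ → UniqueDec.unique? (Fin._≟_ {n}) σ) (seqs n n)

abWords : ℕ → List (List AB)
abWords zero = [] ∷ []
abWords (suc k) = concatMap (λ x → map (x ∷_) (abWords k)) (𝐚 ∷ 𝐛 ∷ [])

letter : Bool → AB
letter true = 𝐛
letter false = 𝐚

-- u_S for S = descent set of σ : u_i = b iff σ_i > σ_{i+1}
desWord : {n : ℕ} → List (Fin n) → List AB
desWord (x ∷ y ∷ r) = letter (toℕ y <ᵇ toℕ x) ∷ desWord (y ∷ r)
desWord _ = []

-- u_S for S = alternating descent set of σ; the flag says whether the
-- current position i is odd (positions start at i = 1).
altDesWordFrom : {n : ℕ} → Bool → List (Fin n) → List AB
altDesWordFrom odd (x ∷ y ∷ r) =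
  letter (if odd then toℕ y <ᵇ toℕ x else toℕ x <ᵇ toℕ y)
    ∷ altDesWordFrom (not odd) (y ∷ r)
altDesWordFrom odd _ = []

altDesWord : {n : ℕ} → List (Fin n) → List AB
altDesWord = altDesWordFrom true

-- β_n(S) and β̂_n(S), with S given by its monomial u_S
β : (n : ℕ) → List AB → ℕ
β n u = length (filter (λ σ → ≡-dec _≟AB_ (desWord σ) u) (perms n))

β̂ : (n : ℕ) → List AB → ℕ
β̂ n u = length (filter (λ σ → ≡-dec _≟AB_ (altDesWord σ) u) (perms n))

Ψ : ℕ → Poly AB
Ψ n = map (λ u → (+ β n u , u)) (abWords (n ∸ 1))

Ψ̂ : ℕ → Poly AB
Ψ̂ n = map (λ u → (+ β̂ n u , u)) (abWords (n ∸ 1))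

module Submission where

-- Polynomials are compared coefficientwise, and coeff p w is the pairing ⟪ δ w ∣ p ⟫ of p
-- with the indicator functional of w.  We therefore work throughout with the pairing
-- ⟪ g ∣ p ⟫ = Σ c · g(u) against an arbitrary functional g on words; it is additive,
-- turns products into iterated pairings and substitutions into pulled-back functionals,
-- so every identity of polynomials below is proved as an identity of pairings.
--
-- (1) The cd-index of the Boolean algebra exists.  Permutations of [n+1] arise from those
--     of [n] by inserting a new minimum 0 at every position (ins n is this list; it is a
--     reordering of perms n).  On descent words this insertion acts as u ↦ (a + b) u + E u,
--     E the derivation a ↦ ab, b ↦ ba; evaluation turns the derivation G (c ↦ d, d ↦ dc)
--     into E, so Φ₁ = 1, Φₙ₊₁ = c Φₙ + G Φₙ evaluates to Ψₙ₊₁ (cdIndex-Ψ).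
-- (2) Twisting: flipping a ↔ b at the even positions fixes a + b and turns ab + ba into
--     aa + bb = (a + b)² − (ab + ba); hence Φ(c, c² − d) evaluates to the twist of the
--     evaluation of Φ (evalCD-c²-d).  For permutations the alternating descent word is the
--     twisted descent word, so β̂ₙ(w) = βₙ(twist w), and (c²-d-Ψ̂) follows.

open import Defs
open import Data.Nat using (ℕ; zero; suc; _∸_; _≤_; z≤n; s≤s; _<ᵇ_) renaming (_≟_ to _≟ℕ_)
open import Data.Nat.Properties using (≤-trans; ≤-reflexive; m≤n⇒m≤1+n; 1+n≰n; suc-injective)
open import Data.Integer using (ℤ; +_; -_; _+_; _*_)
open import Data.Integer.Properties using (+-identityˡ; +-identityʳ; +-assoc; +-comm; *-identityˡ; *-identityʳ; *-zeroʳ)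
open import Data.Integer.Tactic.RingSolver using (solve-∀)
open import Data.Bool using (Bool; true; false; not)
open import Data.Fin using (Fin; toℕ) renaming (zero to fzero; suc to fsuc)
import Data.Fin.Properties as Fin
open import Data.List using (List; []; _∷_; _++_; [_]; map; foldr; concatMap; cartesianProductWith; filter; length)
open import Data.List.Properties using (++-assoc; ∷-injective; length-map; map-++; ≡-dec; filter-none)
open import Data.List.Membership.Propositional using (_∈_; _∉_; find; lose)
open import Data.List.Membership.Propositional.Properties using (∈-cartesianProductWith⁺; ∈-cartesianProductWith⁻; ∈-allFin; ∈-filter⁺; ∈-filter⁻; ∈-∃++; ∈-concatMap⁺; ∈-concatMap⁻; ∈-map⁺; ∈-map⁻)
open import Data.List.Membership.Propositional.Properties.WithK using (unique∧set⇒bag)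
open import Data.List.Relation.Binary.BagAndSetEquality using (∼bag⇒↭)
open import Data.List.Relation.Binary.Permutation.Propositional as ↭ using (_↭_; ↭-sym; ↭-refl; ↭-prep; ↭-swap; ↭-trans; ↭⇒↭ₛ)
open import Data.List.Relation.Binary.Permutation.Propositional.Properties as ↭ using (shift; ↭-length)
import Data.List.Relation.Binary.Permutation.Setoid.Properties as PermutationSetoid
open import Data.List.Relation.Unary.All as All using (All; []; _∷_)
import Data.List.Relation.Unary.All.Properties as All
open import Data.List.Relation.Unary.AllPairs as AllPairs using ([]; _∷_)
import Data.List.Relation.Unary.AllPairs.Properties as AllPairs
open import Data.List.Relation.Unary.Any as Any using (here; there)
open import Data.List.Relation.Unary.Unique.Propositional using (Unique)
open import Data.List.Relation.Unary.Unique.Propositional.Properties as Unique using (cartesianProductWith⁺; concat⁺; filter⁺)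
import Data.List.Relation.Unary.Unique.DecPropositional as UniqueDec
open import Data.Product using (Σ; _×_; _,_; proj₁; proj₂)
open import Data.Empty using (⊥-elim)
open import Function using (_∘_)
open import Function.Bundles using (_⇔_; mk⇔; Equivalence)
open import Relation.Nullary using (yes; no; contradiction)
open import Relation.Unary using (Decidable)
open import Relation.Binary.Definitions using (DecidableEquality)
open import Relation.Binary.PropositionalEquality as ≡ using (_≡_; _≢_; refl; sym; cong; cong₂; subst; setoid; module ≡-Reasoning)

module _ {X : Set} where

  -- The pairing ⟪ g ∣ p ⟫ = Σ c · g(u) of a functional g on words with a
  -- formal sum p; a polynomial is determined by its pairings.
  ⟪_∣_⟫ : (List X → ℤ) → Poly X → ℤ
  ⟪ g ∣ [] ⟫ = + 0
  ⟪ g ∣ (c , u) ∷ p ⟫ = c * g u + ⟪ g ∣ p ⟫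

  pair-++ : ∀ (g : List X → ℤ) p q → ⟪ g ∣ p ++ q ⟫ ≡ ⟪ g ∣ p ⟫ + ⟪ g ∣ q ⟫
  pair-++ g [] q = sym (+-identityˡ _)
  pair-++ g ((c , u) ∷ p) q =
    ≡.trans (cong (_+_ (c * g u)) (pair-++ g p q)) (sym (+-assoc (c * g u) ⟪ g ∣ p ⟫ ⟪ g ∣ q ⟫))

  pair-cong : ∀ {g h : List X → ℤ} → (∀ u → g u ≡ h u) → ∀ p → ⟪ g ∣ p ⟫ ≡ ⟪ h ∣ p ⟫
  pair-cong g≗h [] = refl
  pair-cong g≗h ((c , u) ∷ p) = cong₂ (λ x y → c * x + y) (g≗h u) (pair-cong g≗h p)

  pair-+ : ∀ (g h : List X → ℤ) p → ⟪ (λ u → g u + h u) ∣ p ⟫ ≡ ⟪ g ∣ p ⟫ + ⟪ h ∣ p ⟫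
  pair-+ g h [] = refl
  pair-+ g h ((c , u) ∷ p) =
    ≡.trans (cong (_+_ (c * (g u + h u))) (pair-+ g h p)) (distrib c (g u) (h u) ⟪ g ∣ p ⟫ ⟪ h ∣ p ⟫)
    where
    distrib : ∀ c x y a b → c * (x + y) + (a + b) ≡ (c * x + a) + (c * y + b)
    distrib = solve-∀

  pair-* : ∀ k (g : List X → ℤ) p → ⟪ (λ u → k * g u) ∣ p ⟫ ≡ k * ⟪ g ∣ p ⟫
  pair-* k g [] = sym (*-zeroʳ k)
  pair-* k g ((c , u) ∷ p) =
    ≡.trans (cong (_+_ (c * (k * g u))) (pair-* k g p)) (factor c k (g u) ⟪ g ∣ p ⟫)
    where
    factor : ∀ c k x a → c * (k * x) + k * a ≡ k * (c * x + a)
    factor = solve-∀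

  pair-0 : ∀ (p : Poly X) → ⟪ (λ _ → + 0) ∣ p ⟫ ≡ + 0
  pair-0 [] = refl
  pair-0 ((c , u) ∷ p) =
    ≡.trans (cong (_+_ (c * + 0)) (pair-0 p)) (≡.trans (+-identityʳ (c * + 0)) (*-zeroʳ c))

  pair-scale : ∀ k (g : List X → ℤ) p → ⟪ g ∣ scale k p ⟫ ≡ k * ⟪ g ∣ p ⟫
  pair-scale k g [] = sym (*-zeroʳ k)
  pair-scale k g ((d , u) ∷ p) =
    ≡.trans (cong (_+_ (k * d * g u)) (pair-scale k g p)) (factor k d (g u) ⟪ g ∣ p ⟫)
    where
    factor : ∀ k d x a → k * d * x + k * a ≡ k * (d * x + a)
    factor = solve-∀

  pair-↭ : ∀ (g : List X → ℤ) {p q : Poly X} → p ↭ q → ⟪ g ∣ p ⟫ ≡ ⟪ g ∣ q ⟫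
  pair-↭ g ↭.refl = refl
  pair-↭ g (↭.prep (c , u) p↭q) = cong (_+_ (c * g u)) (pair-↭ g p↭q)
  pair-↭ g (↭.swap (c , u) (d , v) p↭q) =
    ≡.trans (cong (λ r → c * g u + (d * g v + r)) (pair-↭ g p↭q)) (exchange (c * g u) (d * g v) _)
    where
    exchange : ∀ x y r → x + (y + r) ≡ y + (x + r)
    exchange = solve-∀
  pair-↭ g (↭.trans p↭q q↭r) = ≡.trans (pair-↭ g p↭q) (pair-↭ g q↭r)

  one-pair : ∀ (g : List X → ℤ) → ⟪ g ∣ one ⟫ ≡ g []
  one-pair g = ≡.trans (+-identityʳ _) (*-identityˡ _)

  var-pair : ∀ (g : List X → ℤ) x → ⟪ g ∣ var x ⟫ ≡ g (x ∷ [])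
  var-pair g x = ≡.trans (+-identityʳ _) (*-identityˡ _)

  pair-⊗ : ∀ (g : List X → ℤ) p q → ⟪ g ∣ p ⊗ q ⟫ ≡ ⟪ (λ u → ⟪ g ∘ (u ++_) ∣ q ⟫) ∣ p ⟫
  pair-⊗ g [] q = refl
  pair-⊗ g ((c , u) ∷ p) q =
    ≡.trans (pair-++ g (map _ q) (p ⊗ q)) (cong₂ _+_ (pair-prefix _ (λ d v → refl) q) (pair-⊗ g p q))
    where
    pair-prefix : ∀ (F : ℤ × List X → ℤ × List X) → (∀ d v → F (d , v) ≡ (c * d , u ++ v)) →
      ∀ r → ⟪ g ∣ map F r ⟫ ≡ c * ⟪ g ∘ (u ++_) ∣ r ⟫
    pair-prefix F F-prefix [] = sym (*-zeroʳ c)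
    pair-prefix F F-prefix ((d , v) ∷ r) rewrite F-prefix d v =
      ≡.trans (cong (_+_ (c * d * g (u ++ v))) (pair-prefix F F-prefix r)) (factor c d (g (u ++ v)) _)
      where
      factor : ∀ k d x a → k * d * x + k * a ≡ k * (d * x + a)
      factor = solve-∀

  pair-var-⊗ : ∀ (g : List X → ℤ) x p → ⟪ g ∣ var x ⊗ p ⟫ ≡ ⟪ g ∘ (x ∷_) ∣ p ⟫
  pair-var-⊗ g x p = ≡.trans (pair-⊗ g (var x) p) (var-pair (λ u → ⟪ g ∘ (u ++_) ∣ p ⟫) x)

pair-swap : ∀ {X Y : Set} (h : List X → List Y → ℤ) p q →
  ⟪ (λ u → ⟪ h u ∣ q ⟫) ∣ p ⟫ ≡ ⟪ (λ v → ⟪ (λ u → h u v) ∣ p ⟫) ∣ q ⟫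
pair-swap h [] q = sym (pair-0 q)
pair-swap h ((c , u) ∷ p) q = sym (
  ≡.trans (pair-+ (λ v → c * h u v) (λ v → ⟪ (λ u → h u v) ∣ p ⟫) q)
    (cong₂ _+_ (pair-* c (h u) q) (sym (pair-swap h p q))))

module _ {X Y : Set} where

  extend : (List X → Poly Y) → Poly X → Poly Y
  extend F [] = []
  extend F ((c , u) ∷ p) = scale c (F u) ++ extend F p

  pair-extend : ∀ (g : List Y → ℤ) F p → ⟪ g ∣ extend F p ⟫ ≡ ⟪ (λ u → ⟪ g ∣ F u ⟫) ∣ p ⟫
  pair-extend g F [] = refl
  pair-extend g F ((c , u) ∷ p) =
    ≡.trans (pair-++ g (scale c (F u)) (extend F p))
      (cong₂ _+_ (pair-scale c g (F u)) (pair-extend g F p))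

  mono : (X → Poly Y) → List X → Poly Y
  mono f u = foldr (λ x acc → f x ⊗ acc) one u

  substP-extend : ∀ (f : X → Poly Y) p → substP f p ≡ extend (mono f) p
  substP-extend f [] = refl
  substP-extend f ((c , u) ∷ p) = cong (scale c (mono f u) ++_) (substP-extend f p)

  pull : (X → Poly Y) → (List Y → ℤ) → List X → ℤ
  pull f g u = ⟪ g ∣ mono f u ⟫

  pair-substP : ∀ (f : X → Poly Y) g p → ⟪ g ∣ substP f p ⟫ ≡ ⟪ pull f g ∣ p ⟫
  pair-substP f g p = ≡.trans (cong ⟪ g ∣_⟫ (substP-extend f p)) (pair-extend g (mono f) p)

  pull-++ : ∀ (f : X → Poly Y) g u v →
    pull f g (u ++ v) ≡ ⟪ (λ s → pull f (g ∘ (s ++_)) v) ∣ mono f u ⟫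
  pull-++ f g [] v = sym (one-pair (λ s → pull f (g ∘ (s ++_)) v))
  pull-++ f g (x ∷ u) v = begin
    ⟪ g ∣ f x ⊗ mono f (u ++ v) ⟫
      ≡⟨ pair-⊗ g (f x) (mono f (u ++ v)) ⟩
    ⟪ (λ s → pull f (g ∘ (s ++_)) (u ++ v)) ∣ f x ⟫
      ≡⟨ pair-cong (λ s → pull-++ f (g ∘ (s ++_)) u v) (f x) ⟩
    ⟪ (λ s → ⟪ (λ s′ → pull f (g ∘ (s ++_) ∘ (s′ ++_)) v) ∣ mono f u ⟫) ∣ f x ⟫
      ≡⟨ pair-cong (λ s → pair-cong (λ s′ → pair-cong (λ t → cong g (++-assoc s s′ t))
                                                     (mono f v)) (mono f u)) (f x) ⟨
    ⟪ (λ s → ⟪ (λ s′ → pull f (g ∘ ((s ++ s′) ++_)) v) ∣ mono f u ⟫) ∣ f x ⟫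
      ≡⟨ pair-⊗ (λ s → pull f (g ∘ (s ++_)) v) (f x) (mono f u) ⟨
    ⟪ (λ s → pull f (g ∘ (s ++_)) v) ∣ f x ⊗ mono f u ⟫ ∎
    where open ≡-Reasoning

module _ {X : Set} (_≟_ : DecidableEquality X) where

  δ : List X → List X → ℤ
  δ w u with ≡-dec _≟_ u w
  ... | yes _ = + 1
  ... | no _  = + 0

  coeff-pair : ∀ p w → coeff _≟_ p w ≡ ⟪ δ w ∣ p ⟫
  coeff-pair [] w = refl
  coeff-pair ((c , u) ∷ p) w with ≡-dec _≟_ u w
  ... | yes _ = cong₂ _+_ (sym (*-identityʳ c)) (coeff-pair p w)
  ... | no _  = ≡.trans (coeff-pair p w) (sym (≡.trans (cong (_+ ⟪ δ w ∣ p ⟫) (*-zeroʳ c)) (+-identityˡ _)))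

  δ-involution : (ι : List X → List X) → (∀ u → ι (ι u) ≡ u) → ∀ w u → δ w (ι u) ≡ δ (ι w) u
  δ-involution ι ι-inv w u with ≡-dec _≟_ (ι u) w | ≡-dec _≟_ u (ι w)
  ... | yes _  | yes _  = refl
  ... | no _   | no _   = refl
  ... | yes ιu≡w | no u≢ιw = ⊥-elim (u≢ιw (≡.trans (sym (ι-inv u)) (cong ι ιu≡w)))
  ... | no ιu≢w | yes u≡ιw = ⊥-elim (ιu≢w (≡.trans (cong ι u≡ιw) (ι-inv w)))

  coeff-graph-∈ : ∀ (F : List X → ℤ) {L} w → Unique L → w ∈ L →
    coeff _≟_ (map (λ u → (F u , u)) L) w ≡ F w
  coeff-graph-∉ : ∀ (F : List X → ℤ) {L} w → w ∉ L →
    coeff _≟_ (map (λ u → (F u , u)) L) w ≡ + 0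

  coeff-graph-∈ F {u ∷ L} w (u∉L ∷ uniq) w∈u∷L with ≡-dec _≟_ u w | w∈u∷L
  ... | yes refl | _ =
    ≡.trans (cong (_+_ (F u)) (coeff-graph-∉ F w (λ w∈L → All.lookup u∉L w∈L refl))) (+-identityʳ (F u))
  ... | no u≢w | here w≡u = ⊥-elim (u≢w (sym w≡u))
  ... | no _ | there w∈L = coeff-graph-∈ F w uniq w∈L

  coeff-graph-∉ F {[]} w w∉L = refl
  coeff-graph-∉ F {u ∷ L} w w∉L with ≡-dec _≟_ u w
  ... | yes u≡w = ⊥-elim (w∉L (here (sym u≡w)))
  ... | no _    = coeff-graph-∉ F w (w∉L ∘ there)

  pair-δ-count : ∀ {A : Set} (f : A → List X) w L →
    ⟪ δ w ∣ map (λ x → (+ 1 , f x)) L ⟫ ≡ + length (filter (λ x → ≡-dec _≟_ (f x) w) L)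
  pair-δ-count f w [] = refl
  pair-δ-count f w (x ∷ L) with ≡-dec _≟_ (f x) w
  ... | yes _ = cong (_+_ (+ 1)) (pair-δ-count f w L)
  ... | no _  = ≡.trans (+-identityˡ _) (pair-δ-count f w L)

Unique-resp-↭ : {A : Set} {xs ys : List A} → xs ↭ ys → Unique xs → Unique ys
Unique-resp-↭ {A} xs↭ys = PermutationSetoid.Unique-resp-↭ (setoid A) (↭⇒↭ₛ xs↭ys)

unique-sameElements⇒↭ : {A : Set} {xs ys : List A} → Unique xs → Unique ys →
  (∀ {z} → z ∈ xs → z ∈ ys) → (∀ {z} → z ∈ ys → z ∈ xs) → xs ↭ ys
unique-sameElements⇒↭ uxs uys to from = ∼bag⇒↭ (unique∧set⇒bag uxs uys (mk⇔ to from))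

concatMap-unique : {A B : Set} (F : A → List B) {L : List A} → Unique L → All (Unique ∘ F) L →
  (∀ {x y t} → t ∈ F x → t ∈ F y → x ≡ y) → Unique (concatMap F L)
concatMap-unique F uL uF shared =
  concat⁺ (All.map⁺ uF) (AllPairs.map⁺ (AllPairs.map (λ x≢y {_} (t∈Fx , t∈Fy) → x≢y (shared t∈Fx t∈Fy)) uL))

wordsOver : {A : Set} → List A → ℕ → List (List A)
wordsOver xs zero = [] ∷ []
wordsOver xs (suc k) = cartesianProductWith _∷_ xs (wordsOver xs k)

module _ {A : Set} where

  concatMap-prefix : ∀ (xs : List A) (W : List (List A)) →
    concatMap (λ x → map (x ∷_) W) xs ≡ cartesianProductWith _∷_ xs W
  concatMap-prefix [] W = refl
  concatMap-prefix (x ∷ xs) W = cong (map (x ∷_) W ++_) (concatMap-prefix xs W)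

  wordsOver-length : ∀ (xs : List A) k {σ} → σ ∈ wordsOver xs k → length σ ≡ k
  wordsOver-length xs zero (here refl) = refl
  wordsOver-length xs (suc k) σ∈ with ∈-cartesianProductWith⁻ _∷_ xs (wordsOver xs k) σ∈
  ... | _ , τ , _ , τ∈ , refl = cong suc (wordsOver-length xs k τ∈)

  wordsOver-complete : ∀ (xs : List A) {σ} → All (_∈ xs) σ → σ ∈ wordsOver xs (length σ)
  wordsOver-complete xs [] = here refl
  wordsOver-complete xs (x∈xs ∷ σ⊆xs) = ∈-cartesianProductWith⁺ _∷_ x∈xs (wordsOver-complete xs σ⊆xs)

  wordsOver-unique : ∀ {xs : List A} k → Unique xs → Unique (wordsOver xs k)
  wordsOver-unique zero uxs = [] ∷ []
  wordsOver-unique (suc k) uxs = cartesianProductWith⁺ _∷_ ∷-injective uxs (wordsOver-unique k uxs)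

abWords-wordsOver : ∀ k → abWords k ≡ wordsOver (𝐚 ∷ 𝐛 ∷ []) k
abWords-wordsOver zero = refl
abWords-wordsOver (suc k) = ≡.trans
  (cong (λ W → concatMap (λ x → map (x ∷_) W) (𝐚 ∷ 𝐛 ∷ [])) (abWords-wordsOver k))
  (concatMap-prefix (𝐚 ∷ 𝐛 ∷ []) (wordsOver (𝐚 ∷ 𝐛 ∷ []) k))

seqs-wordsOver : ∀ n k → seqs n k ≡ wordsOver (allFin′ n) k
seqs-wordsOver n zero = refl
seqs-wordsOver n (suc k) = ≡.trans
  (cong (λ W → concatMap (λ x → map (x ∷_) W) (allFin′ n)) (seqs-wordsOver n k))
  (concatMap-prefix (allFin′ n) (wordsOver (allFin′ n) k))

module _ (n : ℕ) where

  private
    unique? = λ (σ : List (Fin n)) → UniqueDec.unique? Fin._≟_ σ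

  ∈-perms⁻ : ∀ {σ} → σ ∈ perms n → Unique σ × length σ ≡ n
  ∈-perms⁻ σ∈ with ∈-filter⁻ unique? σ∈
  ... | σ∈seqs , uσ = uσ , wordsOver-length (allFin′ n) n (subst (_ ∈_) (seqs-wordsOver n n) σ∈seqs)

  ∈-perms⁺ : ∀ {σ} → Unique σ → length σ ≡ n → σ ∈ perms n
  ∈-perms⁺ {σ} uσ len = ∈-filter⁺ unique? (subst (σ ∈_) (sym (seqs-wordsOver n n)) σ∈words) uσ
    where
    σ∈words : σ ∈ wordsOver (allFin′ n) n
    σ∈words = subst (λ k → σ ∈ wordsOver (allFin′ n) k) len
      (wordsOver-complete (allFin′ n) (All.tabulate (λ {x} _ → ∈-allFin x)))

  perms-unique : Unique (perms n)
  perms-unique =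
    filter⁺ unique? (subst Unique (sym (seqs-wordsOver n n)) (wordsOver-unique n (Unique.allFin⁺ n)))

module _ {n : ℕ} where

  insertMin : List (Fin (suc n)) → List (List (Fin (suc n)))
  insertMin [] = [ fzero ] ∷ []
  insertMin (y ∷ s) = (fzero ∷ y ∷ s) ∷ map (y ∷_) (insertMin s)

  deleteMin : List (Fin (suc n)) → List (Fin n)
  deleteMin [] = []
  deleteMin (fzero ∷ s) = deleteMin s
  deleteMin (fsuc x ∷ s) = x ∷ deleteMin s

  deleteMin-shift : ∀ τ → deleteMin (map fsuc τ) ≡ τ
  deleteMin-shift [] = refl
  deleteMin-shift (x ∷ τ) = cong (x ∷_) (deleteMin-shift τ)

  deleteMin-insertMin : ∀ s {t} → t ∈ insertMin s → deleteMin t ≡ deleteMin s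
  deleteMin-insertMin [] (here refl) = refl
  deleteMin-insertMin (y ∷ s) (here refl) = refl
  deleteMin-insertMin (y ∷ s) (there t∈) with ∈-map⁻ (y ∷_) t∈
  deleteMin-insertMin (fzero ∷ s) _ | t , t∈ , refl = deleteMin-insertMin s t∈
  deleteMin-insertMin (fsuc y ∷ s) _ | t , t∈ , refl = cong (y ∷_) (deleteMin-insertMin s t∈)

  avoid-min : ∀ σ → fzero ∉ σ → σ ≡ map fsuc (deleteMin σ)
  avoid-min [] _ = refl
  avoid-min (fzero ∷ σ) 0∉σ = ⊥-elim (0∉σ (here refl))
  avoid-min (fsuc x ∷ σ) 0∉σ = cong (fsuc x ∷_) (avoid-min σ (0∉σ ∘ there))

  insertMin-↭ : ∀ s {t} → t ∈ insertMin s → t ↭ fzero ∷ s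
  insertMin-↭ [] (here refl) = ↭-refl
  insertMin-↭ (y ∷ s) (here refl) = ↭-refl
  insertMin-↭ (y ∷ s) (there t∈) with ∈-map⁻ (y ∷_) t∈
  ... | t , t∈′ , refl = ↭-trans (↭-prep y (insertMin-↭ s t∈′)) (↭-swap y fzero ↭-refl)

  insertMin-complete : ∀ pre post → pre ++ fzero ∷ post ∈ insertMin (pre ++ post)
  insertMin-complete [] [] = here refl
  insertMin-complete [] (y ∷ post) = here refl
  insertMin-complete (y ∷ pre) post = there (∈-map⁺ (y ∷_) (insertMin-complete pre post))

  insertMin-length : ∀ τ {t} → t ∈ insertMin (map fsuc τ) → length t ≡ suc (length τ)
  insertMin-length τ t∈ = ≡.trans (↭-length (insertMin-↭ (map fsuc τ) t∈)) (cong suc (length-map fsuc τ))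

  insertMin-unique : ∀ τ → Unique (insertMin (map fsuc τ))
  insertMin-unique [] = [] ∷ []
  insertMin-unique (y ∷ τ) = All.tabulate first≢rest ∷ Unique.map⁺ (proj₂ ∘ ∷-injective) (insertMin-unique τ)
    where
    first≢rest : ∀ {t} → t ∈ map (fsuc y ∷_) (insertMin (map fsuc τ)) → fzero ∷ fsuc y ∷ map fsuc τ ≢ t
    first≢rest t∈ with ∈-map⁻ (fsuc y ∷_) t∈
    ... | _ , _ , refl = λ ()

data MinView {m : ℕ} (σ : List (Fin (suc m))) : Set where
  avoids   : (τ : List (Fin m)) → σ ≡ map fsuc τ → Unique τ → MinView σ
  inserted : (τ : List (Fin m)) → σ ∈ insertMin (map fsuc τ) → Unique τ → MinView σ

minView : ∀ {m} {σ : List (Fin (suc m))} → Unique σ → MinView σ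
minView {σ = σ} uσ with Any.any? (fzero Fin.≟_) σ
... | no 0∉σ = avoids (deleteMin σ) σ≡ (Unique.map⁻ (subst Unique σ≡ uσ))
  where
  σ≡ = avoid-min σ 0∉σ
... | yes 0∈σ with ∈-∃++ 0∈σ
...   | pre , post , refl with Unique-resp-↭ (shift fzero pre post) uσ
...     | 0∉rest ∷ u-rest = inserted (deleteMin (pre ++ post))
          (subst (λ r → pre ++ fzero ∷ post ∈ insertMin r) rest≡ (insertMin-complete pre post))
          (Unique.map⁻ (subst Unique rest≡ u-rest))
  where
  rest≡ = avoid-min (pre ++ post) (λ 0∈rest → All.lookup 0∉rest 0∈rest refl)

ins : (n : ℕ) → List (List (Fin n))
ins zero = [] ∷ []
ins (suc n) = concatMap (insertMin ∘ map fsuc) (ins n)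

ins-unique : ∀ n → Unique (ins n)
ins-unique zero = [] ∷ []
ins-unique (suc n) = concatMap-unique (insertMin ∘ map fsuc) (ins-unique n)
  (All.tabulate (λ {τ} _ → insertMin-unique τ)) same-origin
  where
  same-origin : ∀ {τ τ′ t} → t ∈ insertMin (map fsuc τ) → t ∈ insertMin (map fsuc τ′) → τ ≡ τ′
  same-origin {τ} {τ′} {t} t∈ t∈′ = begin
    τ                        ≡⟨ deleteMin-shift τ ⟨
    deleteMin (map fsuc τ)   ≡⟨ deleteMin-insertMin _ t∈ ⟨
    deleteMin t              ≡⟨ deleteMin-insertMin _ t∈′ ⟩
    deleteMin (map fsuc τ′)  ≡⟨ deleteMin-shift τ′ ⟩
    τ′                       ∎
    where open ≡-Reasoning

ins-sound : ∀ n {σ} → σ ∈ ins n → Unique σ × length σ ≡ n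
ins-sound zero (here refl) = [] , refl
ins-sound (suc n) σ∈ with find (∈-concatMap⁻ (insertMin ∘ map fsuc) {xs = ins n} σ∈)
... | τ , τ∈ , σ∈′ with ins-sound n τ∈
...   | uτ , lenτ =
  Unique-resp-↭ (↭-sym (insertMin-↭ (map fsuc τ) σ∈′))
    (All.map⁺ (All.tabulate (λ _ ())) ∷ Unique.map⁺ Fin.suc-injective uτ) ,
  ≡.trans (insertMin-length τ σ∈′) (cong suc lenτ)

unique-length≤ : ∀ m {τ : List (Fin m)} → Unique τ → length τ ≤ m
unique-length≤ zero {[]} _ = z≤n
unique-length≤ zero {() ∷ _} _
unique-length≤ (suc m) uτ with minView uτ
... | avoids τ′ refl uτ′ = ≤-trans (≤-reflexive (length-map fsuc τ′)) (m≤n⇒m≤1+n (unique-length≤ m uτ′))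
... | inserted τ′ τ∈ uτ′ = ≤-trans (≤-reflexive (insertMin-length τ′ τ∈)) (s≤s (unique-length≤ m uτ′))

ins-complete : ∀ n {σ} → Unique σ → length σ ≡ n → σ ∈ ins n
ins-complete zero {[]} _ _ = here refl
ins-complete (suc n) uσ len with minView uσ
... | avoids τ refl uτ =
  contradiction (subst (_≤ n) (≡.trans (sym (length-map fsuc τ)) len) (unique-length≤ n uτ)) 1+n≰n
... | inserted τ σ∈ uτ =
  ∈-concatMap⁺ (insertMin ∘ map fsuc) (lose (ins-complete n uτ lenτ) σ∈)
  where
  lenτ = suc-injective (≡.trans (sym (insertMin-length τ σ∈)) len)

perms↭ins : ∀ n → perms n ↭ ins n
perms↭ins n = unique-sameElements⇒↭ (perms-unique n) (ins-unique n)
  (λ σ∈ → let (uσ , len) = ∈-perms⁻ n σ∈ in ins-complete n uσ len)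
  (λ σ∈ → let (uσ , len) = ins-sound n σ∈ in ∈-perms⁺ n uσ len)

desSum : ∀ {n} → List (List (Fin n)) → Poly AB
desSum L = map (λ σ → (+ 1 , desWord σ)) L

desWord-shift : ∀ {n} (τ : List (Fin n)) → desWord (map fsuc τ) ≡ desWord τ
desWord-shift [] = refl
desWord-shift (x ∷ []) = refl
desWord-shift (x ∷ y ∷ τ) = cong (letter (toℕ y <ᵇ toℕ x) ∷_) (desWord-shift (y ∷ τ))

-- The derivation E of the ab-words with a ↦ ab, b ↦ ba, seen through its
-- transpose E* acting on functionals: E* g u = Σ_i g(u with u_i replaced by E u_i).
E-letter : AB → List AB
E-letter 𝐚 = 𝐚 ∷ 𝐛 ∷ []
E-letter 𝐛 = 𝐛 ∷ 𝐚 ∷ []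

E* : (List AB → ℤ) → List AB → ℤ
E* g [] = + 0
E* g (x ∷ u) = g (E-letter x ++ u) + E* (g ∘ (x ∷_)) u

E*-++ : ∀ (g : List AB → ℤ) s t → E* g (s ++ t) ≡ E* (g ∘ (_++ t)) s + E* (g ∘ (s ++_)) t
E*-++ g [] t = sym (+-identityˡ _)
E*-++ g (x ∷ s) t = begin
  g (E-letter x ++ s ++ t) + E* (g ∘ (x ∷_)) (s ++ t)
    ≡⟨ cong₂ _+_ (cong g (sym (++-assoc (E-letter x) s t))) (E*-++ (g ∘ (x ∷_)) s t) ⟩
  g ((E-letter x ++ s) ++ t) + (E* (g ∘ (x ∷_) ∘ (_++ t)) s + E* (g ∘ (x ∷_) ∘ (s ++_)) t)
    ≡⟨ +-assoc (g ((E-letter x ++ s) ++ t)) _ _ ⟨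
  E* (g ∘ (_++ t)) (x ∷ s) + E* (g ∘ ((x ∷ s) ++_)) t ∎
  where open ≡-Reasoning

-- Inserting a new minimum into a permutation acts on descent words as the
-- operator u ↦ (a + b) u + E u; T* is its transpose.
T* : (List AB → ℤ) → List AB → ℤ
T* g u = (g (𝐚 ∷ u) + g (𝐛 ∷ u)) + E* g u

desSum-prefix : ∀ (g : List AB → ℤ) {n} (x z : Fin n) L →
  ⟪ g ∣ desSum (map (x ∷_) (map (z ∷_) L)) ⟫ ≡ ⟪ g ∘ (letter (toℕ z <ᵇ toℕ x) ∷_) ∣ desSum (map (z ∷_) L) ⟫
desSum-prefix g x z [] = refl
desSum-prefix g x z (t ∷ L) = cong (_+_ (+ 1 * g (desWord (x ∷ z ∷ t)))) (desSum-prefix g x z L)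

-- moving the inserted minimum one step to the right: b a w + ℓ b w = b ℓ w + (E ℓ) w
insertion-exchange : ∀ (g : List AB → ℤ) ℓ w →
  g (𝐛 ∷ 𝐚 ∷ w) + g (ℓ ∷ 𝐛 ∷ w) ≡ g (𝐛 ∷ ℓ ∷ w) + g (E-letter ℓ ++ w)
insertion-exchange g 𝐚 w = refl
insertion-exchange g 𝐛 w = +-comm (g (𝐛 ∷ 𝐚 ∷ w)) (g (𝐛 ∷ 𝐛 ∷ w))

-- Inserting 0 at the positions after the first entry y of y s gives b u + E u on
-- the descent word u of y s (a telescoping sum over the positions).
insert-after-first : ∀ (g : List AB → ℤ) {n} (y : Fin n) s →
  ⟪ g ∣ desSum (map (fsuc y ∷_) (insertMin (map fsuc s))) ⟫
    ≡ g (𝐛 ∷ desWord (y ∷ s)) + E* g (desWord (y ∷ s))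
insert-after-first g y [] = cong (_+ + 0) (*-identityˡ (g (𝐛 ∷ [])))
insert-after-first g y (z ∷ s) = begin
  + 1 * g (𝐛 ∷ 𝐚 ∷ desWord (map fsuc (z ∷ s))) + ⟪ g ∣ desSum (map (fsuc y ∷_) (map (fsuc z ∷_) I)) ⟫
    ≡⟨ cong₂ (λ w r → + 1 * g (𝐛 ∷ 𝐚 ∷ w) + r) (desWord-shift (z ∷ s)) (desSum-prefix g (fsuc y) (fsuc z) I) ⟩
  + 1 * g (𝐛 ∷ 𝐚 ∷ u) + ⟪ g ∘ (ℓ ∷_) ∣ desSum (map (fsuc z ∷_) I) ⟫
    ≡⟨ cong (_+_ (+ 1 * g (𝐛 ∷ 𝐚 ∷ u))) (insert-after-first (g ∘ (ℓ ∷_)) z s) ⟩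
  + 1 * g (𝐛 ∷ 𝐚 ∷ u) + (g (ℓ ∷ 𝐛 ∷ u) + E* (g ∘ (ℓ ∷_)) u)
    ≡⟨ regroup (g (𝐛 ∷ 𝐚 ∷ u)) (g (ℓ ∷ 𝐛 ∷ u)) _ ⟩
  (g (𝐛 ∷ 𝐚 ∷ u) + g (ℓ ∷ 𝐛 ∷ u)) + E* (g ∘ (ℓ ∷_)) u
    ≡⟨ cong (_+ E* (g ∘ (ℓ ∷_)) u) (insertion-exchange g ℓ u) ⟩
  (g (𝐛 ∷ ℓ ∷ u) + g (E-letter ℓ ++ u)) + E* (g ∘ (ℓ ∷_)) u
    ≡⟨ +-assoc (g (𝐛 ∷ ℓ ∷ u)) _ _ ⟩
  g (𝐛 ∷ ℓ ∷ u) + E* g (ℓ ∷ u) ∎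
  where
  open ≡-Reasoning
  I = insertMin (map fsuc s)
  u = desWord (z ∷ s)
  ℓ = letter (toℕ z <ᵇ toℕ y)
  regroup : ∀ x y r → + 1 * x + (y + r) ≡ (x + y) + r
  regroup = solve-∀

insert-min : ∀ (g : List AB → ℤ) {n} (y : Fin n) s →
  ⟪ g ∣ desSum (insertMin (map fsuc (y ∷ s))) ⟫ ≡ T* g (desWord (y ∷ s))
insert-min g y s = begin
  + 1 * g (𝐚 ∷ desWord (map fsuc (y ∷ s))) + ⟪ g ∣ desSum (map (fsuc y ∷_) (insertMin (map fsuc s))) ⟫
    ≡⟨ cong₂ (λ w r → + 1 * g (𝐚 ∷ w) + r) (desWord-shift (y ∷ s)) (insert-after-first g y s) ⟩
  + 1 * g (𝐚 ∷ u) + (g (𝐛 ∷ u) + E* g u)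
    ≡⟨ regroup (g (𝐚 ∷ u)) (g (𝐛 ∷ u)) (E* g u) ⟩
  T* g u ∎
  where
  open ≡-Reasoning
  u = desWord (y ∷ s)
  regroup : ∀ x y r → + 1 * x + (y + r) ≡ (x + y) + r
  regroup = solve-∀

insert-min-all : ∀ (g : List AB → ℤ) {n} (L : List (List (Fin n))) → All (λ σ → 1 ≤ length σ) L →
  ⟪ g ∣ desSum (concatMap (insertMin ∘ map fsuc) L) ⟫ ≡ ⟪ T* g ∣ desSum L ⟫
insert-min-all g [] [] = refl
insert-min-all g ((y ∷ s) ∷ L) (_ ∷ nonempty) = begin
  ⟪ g ∣ desSum (insertMin (map fsuc (y ∷ s)) ++ concatMap (insertMin ∘ map fsuc) L) ⟫
    ≡⟨ cong ⟪ g ∣_⟫ (map-++ (λ σ → (+ 1 , desWord σ)) (insertMin (map fsuc (y ∷ s)))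
                            (concatMap (insertMin ∘ map fsuc) L)) ⟩
  ⟪ g ∣ desSum (insertMin (map fsuc (y ∷ s))) ++ desSum (concatMap (insertMin ∘ map fsuc) L) ⟫
    ≡⟨ pair-++ g (desSum (insertMin (map fsuc (y ∷ s)))) _ ⟩
  ⟪ g ∣ desSum (insertMin (map fsuc (y ∷ s))) ⟫ + ⟪ g ∣ desSum (concatMap (insertMin ∘ map fsuc) L) ⟫
    ≡⟨ cong₂ _+_ (≡.trans (insert-min g y s) (sym (*-identityˡ _))) (insert-min-all g L nonempty) ⟩
  ⟪ T* g ∣ desSum ((y ∷ s) ∷ L) ⟫ ∎
  where open ≡-Reasoning

ins-step : ∀ n (g : List AB → ℤ) → ⟪ g ∣ desSum (ins (suc (suc n))) ⟫ ≡ ⟪ T* g ∣ desSum (ins (suc n)) ⟫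
ins-step n g = insert-min-all g (ins (suc n))
  (All.tabulate (λ σ∈ → subst (1 ≤_) (sym (proj₂ (ins-sound (suc n) σ∈))) (s≤s z≤n)))

ev : List CD → Poly AB
ev = mono cdToAB

ev* : (List AB → ℤ) → List CD → ℤ
ev* = pull cdToAB

ev*-c : ∀ (g : List AB → ℤ) t → ev* g (𝐜 ∷ t) ≡ ev* (g ∘ (𝐚 ∷_)) t + ev* (g ∘ (𝐛 ∷_)) t
ev*-c g t = ≡.trans (pair-⊗ g (cdToAB 𝐜) (ev t)) (unit (ev* (g ∘ (𝐚 ∷_)) t) (ev* (g ∘ (𝐛 ∷_)) t))
  where
  unit : ∀ x y → + 1 * x + (+ 1 * y + + 0) ≡ x + y
  unit = solve-∀

ev*-d : ∀ (g : List AB → ℤ) t → ev* g (𝐝 ∷ t) ≡ ev* (g ∘ (𝐚 ∷_) ∘ (𝐛 ∷_)) t + ev* (g ∘ (𝐛 ∷_) ∘ (𝐚 ∷_)) t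
ev*-d g t = ≡.trans (pair-⊗ g (cdToAB 𝐝) (ev t))
  (unit (ev* (g ∘ (𝐚 ∷_) ∘ (𝐛 ∷_)) t) (ev* (g ∘ (𝐛 ∷_) ∘ (𝐚 ∷_)) t))
  where
  unit : ∀ x y → + 1 * + 1 * x + (+ 1 * + 1 * y + + 0) ≡ x + y
  unit = solve-∀

G-letter : CD → List CD
G-letter 𝐜 = 𝐝 ∷ []
G-letter 𝐝 = 𝐝 ∷ 𝐜 ∷ []

G : List CD → Poly CD
G [] = []
G (x ∷ w) = (+ 1 , G-letter x ++ w) ∷ var x ⊗ G w

E*-letter : ∀ (g : List AB → ℤ) x → ⟪ E* g ∣ cdToAB x ⟫ ≡ ev* g (G-letter x)
E*-letter g 𝐜 = regroup (g (𝐚 ∷ 𝐛 ∷ [])) (g (𝐛 ∷ 𝐚 ∷ []))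
  where
  regroup : ∀ x y → + 1 * (x + + 0) + (+ 1 * (y + + 0) + + 0) ≡ + 1 * x + (+ 1 * y + + 0)
  regroup = solve-∀
E*-letter g 𝐝 = regroup (g (𝐚 ∷ 𝐛 ∷ 𝐛 ∷ [])) (g (𝐚 ∷ 𝐛 ∷ 𝐚 ∷ [])) (g (𝐛 ∷ 𝐚 ∷ 𝐚 ∷ [])) (g (𝐛 ∷ 𝐚 ∷ 𝐛 ∷ []))
  where
  regroup : ∀ x y z w → + 1 * (x + (y + + 0)) + (+ 1 * (z + (w + + 0)) + + 0)
                      ≡ + 1 * y + (+ 1 * x + (+ 1 * z + (+ 1 * w + + 0)))
  regroup = solve-∀

E*-ev : ∀ w (g : List AB → ℤ) → ⟪ E* g ∣ ev w ⟫ ≡ ⟪ ev* g ∣ G w ⟫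
E*-ev [] g = refl
E*-ev (x ∷ w) g = begin
  ⟪ E* g ∣ cdToAB x ⊗ ev w ⟫
    ≡⟨ pair-⊗ (E* g) (cdToAB x) (ev w) ⟩
  ⟪ (λ s → ⟪ E* g ∘ (s ++_) ∣ ev w ⟫) ∣ cdToAB x ⟫
    ≡⟨ pair-cong (λ s → ≡.trans (pair-cong (E*-++ g s) (ev w)) (pair-+ (E*-left s) (E*-right s) (ev w)))
                 (cdToAB x) ⟩
  ⟪ (λ s → ⟪ E*-left s ∣ ev w ⟫ + ⟪ E*-right s ∣ ev w ⟫) ∣ cdToAB x ⟫
    ≡⟨ pair-+ (λ s → ⟪ E*-left s ∣ ev w ⟫) (λ s → ⟪ E*-right s ∣ ev w ⟫) (cdToAB x) ⟩
  ⟪ (λ s → ⟪ E*-left s ∣ ev w ⟫) ∣ cdToAB x ⟫ + ⟪ (λ s → ⟪ E*-right s ∣ ev w ⟫) ∣ cdToAB x ⟫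
    ≡⟨ cong₂ _+_ derive-letter derive-rest ⟩
  + 1 * ev* g (G-letter x ++ w) + ⟪ ev* g ∣ var x ⊗ G w ⟫ ∎
  where
  open ≡-Reasoning
  E*-left E*-right : List AB → List AB → ℤ
  E*-left s t = E* (g ∘ (_++ t)) s
  E*-right s t = E* (g ∘ (s ++_)) t

  derive-letter : ⟪ (λ s → ⟪ E*-left s ∣ ev w ⟫) ∣ cdToAB x ⟫ ≡ + 1 * ev* g (G-letter x ++ w)
  derive-letter = begin
    ⟪ (λ s → ⟪ E*-left s ∣ ev w ⟫) ∣ cdToAB x ⟫
      ≡⟨ pair-swap E*-left (cdToAB x) (ev w) ⟩
    ⟪ (λ t → ⟪ E* (g ∘ (_++ t)) ∣ cdToAB x ⟫) ∣ ev w ⟫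
      ≡⟨ pair-cong (λ t → E*-letter (g ∘ (_++ t)) x) (ev w) ⟩
    ⟪ (λ t → ⟪ g ∘ (_++ t) ∣ ev (G-letter x) ⟫) ∣ ev w ⟫
      ≡⟨ pair-swap (λ s t → g (s ++ t)) (ev (G-letter x)) (ev w) ⟨
    ⟪ (λ s → ev* (g ∘ (s ++_)) w) ∣ ev (G-letter x) ⟫
      ≡⟨ pull-++ cdToAB g (G-letter x) w ⟨
    ev* g (G-letter x ++ w)
      ≡⟨ *-identityˡ _ ⟨
    + 1 * ev* g (G-letter x ++ w) ∎

  derive-rest : ⟪ (λ s → ⟪ E*-right s ∣ ev w ⟫) ∣ cdToAB x ⟫ ≡ ⟪ ev* g ∣ var x ⊗ G w ⟫
  derive-rest = begin
    ⟪ (λ s → ⟪ E*-right s ∣ ev w ⟫) ∣ cdToAB x ⟫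
      ≡⟨ pair-cong (λ s → E*-ev w (g ∘ (s ++_))) (cdToAB x) ⟩
    ⟪ (λ s → ⟪ ev* (g ∘ (s ++_)) ∣ G w ⟫) ∣ cdToAB x ⟫
      ≡⟨ pair-swap (λ s v → ev* (g ∘ (s ++_)) v) (cdToAB x) (G w) ⟩
    ⟪ (λ v → ⟪ (λ s → ev* (g ∘ (s ++_)) v) ∣ cdToAB x ⟫) ∣ G w ⟫
      ≡⟨ pair-cong (λ v → pair-⊗ g (cdToAB x) (ev v)) (G w) ⟨
    ⟪ ev* g ∘ (x ∷_) ∣ G w ⟫
      ≡⟨ pair-var-⊗ (ev* g) x (G w) ⟨
    ⟪ ev* g ∣ var x ⊗ G w ⟫ ∎

T*-ev : ∀ (g : List AB → ℤ) w → ev* g (𝐜 ∷ w) + ⟪ ev* g ∣ G w ⟫ ≡ ev* (T* g) w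
T*-ev g w = begin
  ev* g (𝐜 ∷ w) + ⟪ ev* g ∣ G w ⟫
    ≡⟨ cong₂ _+_ (sym (ev*-c g w)) (E*-ev w g) ⟨
  (⟪ g ∘ (𝐚 ∷_) ∣ ev w ⟫ + ⟪ g ∘ (𝐛 ∷_) ∣ ev w ⟫) + ⟪ E* g ∣ ev w ⟫
    ≡⟨ cong (_+ ⟪ E* g ∣ ev w ⟫) (pair-+ (g ∘ (𝐚 ∷_)) (g ∘ (𝐛 ∷_)) (ev w)) ⟨
  ⟪ (λ u → g (𝐚 ∷ u) + g (𝐛 ∷ u)) ∣ ev w ⟫ + ⟪ E* g ∣ ev w ⟫
    ≡⟨ pair-+ (λ u → g (𝐚 ∷ u) + g (𝐛 ∷ u)) (E* g) (ev w) ⟨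
  ev* (T* g) w ∎
  where open ≡-Reasoning

-- Stanley's recursion: Φ₁ = 1 and Φₙ₊₁ = c Φₙ + G Φₙ; cdIndex n is Φₙ₊₁.
cdStep : Poly CD → Poly CD
cdStep P = var 𝐜 ⊗ P ⊕ extend G P

cdIndex : ℕ → Poly CD
cdIndex zero = one
cdIndex (suc n) = cdStep (cdIndex n)

cdStep-ev : ∀ P (g : List AB → ℤ) → ⟪ g ∣ evalCD (cdStep P) ⟫ ≡ ⟪ T* g ∣ evalCD P ⟫
cdStep-ev P g = begin
  ⟪ g ∣ evalCD (cdStep P) ⟫
    ≡⟨ pair-substP cdToAB g (cdStep P) ⟩
  ⟪ ev* g ∣ var 𝐜 ⊗ P ++ extend G P ⟫
    ≡⟨ pair-++ (ev* g) (var 𝐜 ⊗ P) (extend G P) ⟩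
  ⟪ ev* g ∣ var 𝐜 ⊗ P ⟫ + ⟪ ev* g ∣ extend G P ⟫
    ≡⟨ cong₂ _+_ (pair-var-⊗ (ev* g) 𝐜 P) (pair-extend (ev* g) G P) ⟩
  ⟪ ev* g ∘ (𝐜 ∷_) ∣ P ⟫ + ⟪ (λ w → ⟪ ev* g ∣ G w ⟫) ∣ P ⟫
    ≡⟨ pair-+ (ev* g ∘ (𝐜 ∷_)) (λ w → ⟪ ev* g ∣ G w ⟫) P ⟨
  ⟪ (λ w → ev* g (𝐜 ∷ w) + ⟪ ev* g ∣ G w ⟫) ∣ P ⟫
    ≡⟨ pair-cong (T*-ev g) P ⟩
  ⟪ ev* (T* g) ∣ P ⟫
    ≡⟨ pair-substP cdToAB (T* g) P ⟨
  ⟪ T* g ∣ evalCD P ⟫ ∎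
  where open ≡-Reasoning

cdIndex-desSum : ∀ n (g : List AB → ℤ) → ⟪ g ∣ evalCD (cdIndex n) ⟫ ≡ ⟪ g ∣ desSum (ins (suc n)) ⟫
cdIndex-desSum zero g = refl
cdIndex-desSum (suc n) g = begin
  ⟪ g ∣ evalCD (cdStep (cdIndex n)) ⟫      ≡⟨ cdStep-ev (cdIndex n) g ⟩
  ⟪ T* g ∣ evalCD (cdIndex n) ⟫            ≡⟨ cdIndex-desSum n (T* g) ⟩
  ⟪ T* g ∣ desSum (ins (suc n)) ⟫          ≡⟨ ins-step n g ⟨
  ⟪ g ∣ desSum (ins (suc (suc n))) ⟫ ∎
  where open ≡-Reasoning

-- The twist flips a ↔ b at the even positions; the flag records whether the
-- current position is odd.
twistLetter : Bool → AB → AB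
twistLetter true x = x
twistLetter false 𝐚 = 𝐛
twistLetter false 𝐛 = 𝐚

twist : Bool → List AB → List AB
twist odd [] = []
twist odd (x ∷ u) = twistLetter odd x ∷ twist (not odd) u

twist-involutive : ∀ odd u → twist odd (twist odd u) ≡ u
twist-involutive odd [] = refl
twist-involutive odd (x ∷ u) = cong₂ _∷_ (letter-involutive odd x) (twist-involutive (not odd) u)
  where
  letter-involutive : ∀ odd x → twistLetter odd (twistLetter odd x) ≡ x
  letter-involutive true x = refl
  letter-involutive false 𝐚 = refl
  letter-involutive false 𝐛 = refl

twist-transpose : ∀ odd u w → (twist odd u ≡ w) ⇔ (u ≡ twist odd w)
twist-transpose odd u w = mk⇔
  (λ twist-u≡w → ≡.trans (sym (twist-involutive odd u)) (cong (twist odd) twist-u≡w))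
  (λ u≡twist-w → ≡.trans (cong (twist odd) u≡twist-w) (twist-involutive odd w))

<ᵇ-flip : ∀ m n → m ≢ n → (m <ᵇ n) ≡ not (n <ᵇ m)
<ᵇ-flip zero zero m≢n = ⊥-elim (m≢n refl)
<ᵇ-flip zero (suc n) _ = refl
<ᵇ-flip (suc m) zero _ = refl
<ᵇ-flip (suc m) (suc n) m≢n = <ᵇ-flip m n (m≢n ∘ cong suc)

-- For a sequence without repeated entries the alternating descent word is the
-- twisted descent word: at even positions an ascent is exactly a non-descent.
altDesWord-twist : ∀ {n} odd (σ : List (Fin n)) → Unique σ → altDesWordFrom odd σ ≡ twist odd (desWord σ)
altDesWord-twist odd [] _ = refl
altDesWord-twist odd (x ∷ []) _ = refl
altDesWord-twist true (x ∷ y ∷ σ) (_ ∷ uσ) = cong (_ ∷_) (altDesWord-twist false (y ∷ σ) uσ)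
altDesWord-twist false (x ∷ y ∷ σ) ((x≢y ∷ _) ∷ uσ) =
  cong₂ _∷_ (≡.trans (cong letter (<ᵇ-flip (toℕ x) (toℕ y) (x≢y ∘ Fin.toℕ-injective)))
                     (flip-letter (toℕ y <ᵇ toℕ x)))
            (altDesWord-twist true (y ∷ σ) uσ)
  where
  flip-letter : ∀ b → letter (not b) ≡ twistLetter false (letter b)
  flip-letter true = refl
  flip-letter false = refl

length-filter-⇔ : ∀ {A : Set} {P Q : A → Set} (P? : Decidable P) (Q? : Decidable Q) {L} →
  All (λ x → P x ⇔ Q x) L → length (filter P? L) ≡ length (filter Q? L)
length-filter-⇔ P? Q? [] = refl
length-filter-⇔ P? Q? {x ∷ L} (P⇔Q ∷ rest) with P? x | Q? x
... | yes _ | yes _ = cong suc (length-filter-⇔ P? Q? rest)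
... | no _  | no _  = length-filter-⇔ P? Q? rest
... | yes p | no ¬q = contradiction (Equivalence.to P⇔Q p) ¬q
... | no ¬p | yes q = contradiction (Equivalence.from P⇔Q q) ¬p

β̂≡β∘twist : ∀ n w → β̂ n w ≡ β n (twist true w)
β̂≡β∘twist n w = length-filter-⇔
  (λ σ → ≡-dec _≟AB_ (altDesWord σ) w) (λ σ → ≡-dec _≟AB_ (desWord σ) (twist true w))
  (All.tabulate (λ {σ} σ∈ → subst (λ u → (u ≡ w) ⇔ (desWord σ ≡ twist true w))
     (sym (altDesWord-twist true σ (proj₁ (∈-perms⁻ n σ∈)))) (twist-transpose true (desWord σ) w)))

c-invariant : ∀ odd (k : AB → ℤ) → k (twistLetter odd 𝐚) + k (twistLetter odd 𝐛) ≡ k 𝐚 + k 𝐛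
c-invariant true k = refl
c-invariant false k = +-comm (k 𝐛) (k 𝐚)

d-twisted : ∀ odd (k : AB → AB → ℤ) →
  k (twistLetter odd 𝐚) (twistLetter (not odd) 𝐛) + k (twistLetter odd 𝐛) (twistLetter (not odd) 𝐚)
    ≡ k 𝐚 𝐚 + k 𝐛 𝐛
d-twisted true k = refl
d-twisted false k = +-comm (k 𝐛 𝐛) (k 𝐚 𝐚)

ev*-cc : ∀ (g : List AB → ℤ) t → ev* g (𝐜 ∷ 𝐜 ∷ t) ≡
  (ev* (g ∘ (𝐚 ∷_) ∘ (𝐚 ∷_)) t + ev* (g ∘ (𝐚 ∷_) ∘ (𝐛 ∷_)) t)
    + (ev* (g ∘ (𝐛 ∷_) ∘ (𝐚 ∷_)) t + ev* (g ∘ (𝐛 ∷_) ∘ (𝐛 ∷_)) t)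
ev*-cc g t = ≡.trans (ev*-c g (𝐜 ∷ t)) (cong₂ _+_ (ev*-c (g ∘ (𝐚 ∷_)) t) (ev*-c (g ∘ (𝐛 ∷_)) t))

-- Under c ↦ c, d ↦ c² − d the evaluation of a cd-word becomes its twisted evaluation,
-- because the twist fixes a + b and maps ab + ba (at positions i, i+1) to aa + bb.
c²-d-twist : ∀ w odd (g : List AB → ℤ) → pull c,c²-d (ev* g) w ≡ ev* (g ∘ twist odd) w
c²-d-twist [] odd g = one-pair (ev* g)
c²-d-twist (𝐜 ∷ w) odd g = begin
  ⟪ ev* g ∣ var 𝐜 ⊗ q ⟫
    ≡⟨ pair-var-⊗ (ev* g) 𝐜 q ⟩
  ⟪ ev* g ∘ (𝐜 ∷_) ∣ q ⟫
    ≡⟨ pair-cong (ev*-c g) q ⟩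
  ⟪ (λ t → ev* (g ∘ (𝐚 ∷_)) t + ev* (g ∘ (𝐛 ∷_)) t) ∣ q ⟫
    ≡⟨ pair-+ (ev* (g ∘ (𝐚 ∷_))) (ev* (g ∘ (𝐛 ∷_))) q ⟩
  pull c,c²-d (ev* (g ∘ (𝐚 ∷_))) w + pull c,c²-d (ev* (g ∘ (𝐛 ∷_))) w
    ≡⟨ cong₂ _+_ (c²-d-twist w (not odd) (g ∘ (𝐚 ∷_))) (c²-d-twist w (not odd) (g ∘ (𝐛 ∷_))) ⟩
  ev* (g ∘ (𝐚 ∷_) ∘ twist (not odd)) w + ev* (g ∘ (𝐛 ∷_) ∘ twist (not odd)) w
    ≡⟨ c-invariant odd (λ x → ev* (g ∘ (x ∷_) ∘ twist (not odd)) w) ⟨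
  ev* (g ∘ twist odd ∘ (𝐚 ∷_)) w + ev* (g ∘ twist odd ∘ (𝐛 ∷_)) w
    ≡⟨ ev*-c (g ∘ twist odd) w ⟨
  ev* (g ∘ twist odd) (𝐜 ∷ w) ∎
  where
  open ≡-Reasoning
  q = mono c,c²-d w
c²-d-twist (𝐝 ∷ w) odd g = begin
  ⟪ ev* g ∣ (var 𝐜 ⊗ var 𝐜 ⊖ var 𝐝) ⊗ q ⟫
    ≡⟨ pair-⊗ (ev* g) (var 𝐜 ⊗ var 𝐜 ⊖ var 𝐝) q ⟩
  + 1 * + 1 * ⟪ ev* g ∘ (𝐜 ∷_) ∘ (𝐜 ∷_) ∣ q ⟫ + ((- + 1) * + 1 * ⟪ ev* g ∘ (𝐝 ∷_) ∣ q ⟫ + + 0)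
    ≡⟨ cong₂ (λ X Y → + 1 * + 1 * X + ((- + 1) * + 1 * Y + + 0)) cc-part d-part ⟩
  + 1 * + 1 * ((L 𝐚 𝐚 + L 𝐚 𝐛) + (L 𝐛 𝐚 + L 𝐛 𝐛)) + ((- + 1) * + 1 * (L 𝐚 𝐛 + L 𝐛 𝐚) + + 0)
    ≡⟨ cancel (L 𝐚 𝐚) (L 𝐚 𝐛) (L 𝐛 𝐚) (L 𝐛 𝐛) ⟩
  L 𝐚 𝐚 + L 𝐛 𝐛
    ≡⟨ cong₂ _+_ (c²-d-twist w odd′ (g ∘ (𝐚 ∷_) ∘ (𝐚 ∷_))) (c²-d-twist w odd′ (g ∘ (𝐛 ∷_) ∘ (𝐛 ∷_))) ⟩
  ev* (g ∘ (𝐚 ∷_) ∘ (𝐚 ∷_) ∘ twist odd′) w + ev* (g ∘ (𝐛 ∷_) ∘ (𝐛 ∷_) ∘ twist odd′) w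
    ≡⟨ d-twisted odd (λ x y → ev* (g ∘ (x ∷_) ∘ (y ∷_) ∘ twist odd′) w) ⟨
  ev* (g ∘ twist odd ∘ (𝐚 ∷_) ∘ (𝐛 ∷_)) w + ev* (g ∘ twist odd ∘ (𝐛 ∷_) ∘ (𝐚 ∷_)) w
    ≡⟨ ev*-d (g ∘ twist odd) w ⟨
  ev* (g ∘ twist odd) (𝐝 ∷ w) ∎
  where
  open ≡-Reasoning
  q = mono c,c²-d w
  -- the parity two positions further on
  odd′ = not (not odd)
  L : AB → AB → ℤ
  L x y = pull c,c²-d (ev* (g ∘ (x ∷_) ∘ (y ∷_))) w

  cc-part : ⟪ ev* g ∘ (𝐜 ∷_) ∘ (𝐜 ∷_) ∣ q ⟫ ≡ (L 𝐚 𝐚 + L 𝐚 𝐛) + (L 𝐛 𝐚 + L 𝐛 𝐛)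
  cc-part = ≡.trans (pair-cong (ev*-cc g) q) (≡.trans (pair-+ _ _ q)
    (cong₂ _+_ (pair-+ (ev* (g ∘ (𝐚 ∷_) ∘ (𝐚 ∷_))) (ev* (g ∘ (𝐚 ∷_) ∘ (𝐛 ∷_))) q)
               (pair-+ (ev* (g ∘ (𝐛 ∷_) ∘ (𝐚 ∷_))) (ev* (g ∘ (𝐛 ∷_) ∘ (𝐛 ∷_))) q)))

  d-part : ⟪ ev* g ∘ (𝐝 ∷_) ∣ q ⟫ ≡ L 𝐚 𝐛 + L 𝐛 𝐚
  d-part = ≡.trans (pair-cong (ev*-d g) q)
    (pair-+ (ev* (g ∘ (𝐚 ∷_) ∘ (𝐛 ∷_))) (ev* (g ∘ (𝐛 ∷_) ∘ (𝐚 ∷_))) q)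

  -- (aa + ab + ba + bb) − (ab + ba) = aa + bb
  cancel : ∀ A B C D → + 1 * + 1 * ((A + B) + (C + D)) + ((- + 1) * + 1 * (B + C) + + 0) ≡ A + D
  cancel = solve-∀

evalCD-c²-d : ∀ (g : List AB → ℤ) P → ⟪ g ∣ evalCD (substP c,c²-d P) ⟫ ≡ ⟪ g ∘ twist true ∣ evalCD P ⟫
evalCD-c²-d g P = begin
  ⟪ g ∣ evalCD (substP c,c²-d P) ⟫          ≡⟨ pair-substP cdToAB g (substP c,c²-d P) ⟩
  ⟪ ev* g ∣ substP c,c²-d P ⟫               ≡⟨ pair-substP c,c²-d (ev* g) P ⟩
  ⟪ pull c,c²-d (ev* g) ∣ P ⟫               ≡⟨ pair-cong (λ w → c²-d-twist w true g) P ⟩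
  ⟪ ev* (g ∘ twist true) ∣ P ⟫              ≡⟨ pair-substP cdToAB (g ∘ twist true) P ⟨
  ⟪ g ∘ twist true ∣ evalCD P ⟫ ∎
  where open ≡-Reasoning

desWord-length : ∀ {n} (σ : List (Fin n)) → length (desWord σ) ≡ length σ ∸ 1
desWord-length [] = refl
desWord-length (x ∷ []) = refl
desWord-length (x ∷ y ∷ σ) = cong suc (desWord-length (y ∷ σ))

altDesWordFrom-length : ∀ {n} odd (σ : List (Fin n)) → length (altDesWordFrom odd σ) ≡ length σ ∸ 1
altDesWordFrom-length odd [] = refl
altDesWordFrom-length odd (x ∷ []) = refl
altDesWordFrom-length odd (x ∷ y ∷ σ) = cong suc (altDesWordFrom-length (not odd) (y ∷ σ))

ab-unique : Unique (𝐚 ∷ 𝐛 ∷ [])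
ab-unique = ((λ ()) ∷ []) ∷ [] ∷ []

ab-complete : ∀ x → x ∈ 𝐚 ∷ 𝐛 ∷ []
ab-complete 𝐚 = here refl
ab-complete 𝐛 = there (here refl)

fibre-count-coeff : ∀ {A : Set} (f : A → List AB) L k → All (λ x → length (f x) ≡ k) L → ∀ w →
  coeff _≟AB_ (map (λ u → (+ length (filter (λ x → ≡-dec _≟AB_ (f x) u) L) , u)) (abWords k)) w
    ≡ + length (filter (λ x → ≡-dec _≟AB_ (f x) w) L)
fibre-count-coeff f L k lengths w rewrite abWords-wordsOver k with length w ≟ℕ k
... | yes refl = coeff-graph-∈ _≟AB_ count w (wordsOver-unique k ab-unique)
  (wordsOver-complete (𝐚 ∷ 𝐛 ∷ []) (All.tabulate λ {x} _ → ab-complete x))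
  where
  count = λ u → + length (filter (λ x → ≡-dec _≟AB_ (f x) u) L)
... | no |w|≢k = ≡.trans (coeff-graph-∉ _≟AB_ _ w (|w|≢k ∘ wordsOver-length (𝐚 ∷ 𝐛 ∷ []) k))
  (cong (λ xs → + length xs) (sym empty-fibre))
  where
  empty-fibre : filter (λ x → ≡-dec _≟AB_ (f x) w) L ≡ []
  empty-fibre = filter-none (λ x → ≡-dec _≟AB_ (f x) w)
    (All.map (λ |fx|≡k fx≡w → |w|≢k (≡.trans (cong length (sym fx≡w)) |fx|≡k)) lengths)

Ψ-coeff : ∀ n w → coeff _≟AB_ (Ψ n) w ≡ + β n w
Ψ-coeff n = fibre-count-coeff desWord (perms n) (n ∸ 1)
  (All.tabulate λ {σ} σ∈ → ≡.trans (desWord-length σ) (cong (_∸ 1) (proj₂ (∈-perms⁻ n σ∈))))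

Ψ̂-coeff : ∀ n w → coeff _≟AB_ (Ψ̂ n) w ≡ + β̂ n w
Ψ̂-coeff n = fibre-count-coeff altDesWord (perms n) (n ∸ 1)
  (All.tabulate λ {σ} σ∈ → ≡.trans (altDesWordFrom-length true σ) (cong (_∸ 1) (proj₂ (∈-perms⁻ n σ∈))))

cdIndex-Ψ : ∀ m → evalCD (cdIndex m) ≈ab Ψ (suc m)
cdIndex-Ψ m w = begin
  coeff _≟AB_ (evalCD (cdIndex m)) w          ≡⟨ coeff-pair _≟AB_ (evalCD (cdIndex m)) w ⟩
  ⟪ δ _≟AB_ w ∣ evalCD (cdIndex m) ⟫          ≡⟨ cdIndex-desSum m (δ _≟AB_ w) ⟩
  ⟪ δ _≟AB_ w ∣ desSum (ins (suc m)) ⟫        ≡⟨ pair-↭ (δ _≟AB_ w) (↭.map⁺ _ (perms↭ins (suc m))) ⟨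
  ⟪ δ _≟AB_ w ∣ desSum (perms (suc m)) ⟫      ≡⟨ pair-δ-count _≟AB_ desWord w (perms (suc m)) ⟩
  + β (suc m) w                               ≡⟨ Ψ-coeff (suc m) w ⟨
  coeff _≟AB_ (Ψ (suc m)) w ∎
  where open ≡-Reasoning

c²-d-Ψ̂ : ∀ n Φ → evalCD Φ ≈ab Ψ n → evalCD (substP c,c²-d Φ) ≈ab Ψ̂ n
c²-d-Ψ̂ n Φ Φ-is-cd-index w = begin
  coeff _≟AB_ (evalCD (substP c,c²-d Φ)) w
    ≡⟨ coeff-pair _≟AB_ (evalCD (substP c,c²-d Φ)) w ⟩
  ⟪ δ _≟AB_ w ∣ evalCD (substP c,c²-d Φ) ⟫
    ≡⟨ evalCD-c²-d (δ _≟AB_ w) Φ ⟩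
  ⟪ δ _≟AB_ w ∘ twist true ∣ evalCD Φ ⟫
    ≡⟨ pair-cong (δ-involution _≟AB_ (twist true) (twist-involutive true) w) (evalCD Φ) ⟩
  ⟪ δ _≟AB_ (twist true w) ∣ evalCD Φ ⟫
    ≡⟨ coeff-pair _≟AB_ (evalCD Φ) (twist true w) ⟨
  coeff _≟AB_ (evalCD Φ) (twist true w)
    ≡⟨ Φ-is-cd-index (twist true w) ⟩
  coeff _≟AB_ (Ψ n) (twist true w)
    ≡⟨ Ψ-coeff n (twist true w) ⟩
  + β n (twist true w)
    ≡⟨ cong +_ (β̂≡β∘twist n w) ⟨
  + β̂ n w
    ≡⟨ Ψ̂-coeff n w ⟨
  coeff _≟AB_ (Ψ̂ n) w ∎
  where open ≡-Reasoning

proposition7p2 : (n : ℕ) → 1 ≤ n →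
    Σ (Poly CD) (λ Φ̂ → evalCD Φ̂ ≈ab Ψ̂ n)
    × ((Φ : Poly CD) → evalCD Φ ≈ab Ψ n → evalCD (substP c,c²-d Φ) ≈ab Ψ̂ n)
proposition7p2 (suc m) (s≤s z≤n) =
  (substP c,c²-d (cdIndex m) , c²-d-Ψ̂ (suc m) (cdIndex m) (cdIndex-Ψ m)) , c²-d-Ψ̂ (suc m)
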